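{- Let $n \ge 2$. The minimum length of a solution to the \((n-1)\)-out-of-\(n\) picture-hanging puzzle (on nails $1,\dots,n$) is exactly $2n$, and this minimum is attained by the expression $1 + 2 + \cdots + n - 1 - 2 - \cdots - n$.
   Context: Expressions are elements of the free group on the variables (nails) $1,\dots,n$, written additively: $+$ is the (non-commutative) group operation, $-x$ the inverse, $0$ the identity (empty word); here $-1-2-\cdots-n$ means the inverses of the generators $1,2,\dots,n$ in that order. The length of an expression is the number of signed letters in its freely reduced word. For a set $S$ of nails, $w|_S$ denotes the expression obtained from $w$ by setting every variable in $S$ to $0$. A solution to the $k$-out-of-$n$ puzzle (Demaine's convention) is an expression $w$ in the variables $1,\dots,n$ such that: (a) $w \neq 0$; (b) for every set $S$ of $k$ variables, $w|_S = 0$; (c) for every set $S$ of fewer than $k$ variables, $w|_S \neq 0$. -}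

module Defs where

open import Data.Nat using (ℕ; zero; suc; _<_)
open import Data.Bool using (Bool; true; false; not; _∧_)
open import Data.Fin using (Fin; zero; suc)
open import Data.Fin.Properties using () renaming (_≟_ to _≟ᶠ_)
open import Data.Fin.Subset using (Subset; inside; outside; ∣_∣)
open import Data.Vec using (lookup)
open import Data.List using (List; []; _∷_; _++_; map; allFin)
open import Data.Product using (_×_; _,_)
open import Relation.Nullary using (¬_; does)
open import Relation.Binary.PropositionalEquality using (_≡_)

-- A signed letter over nails 1..n (nail i+1 is represented by (i : Fin n)).
-- (i , true) is the generator, (i , false) its inverse.
Letter : ℕ → Set
Letter n = Fin n × Bool

-- Words (expressions) in the free group; elements of the free group are
-- words up to free reduction.
Word : ℕ → Set
Word n = List (Letter n)

inverse? : ∀ {n} → Letter n → Letter n → Bool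
inverse? (i , s) (j , t) = does (i ≟ᶠ j) ∧ not (does (s Data.Bool.≟ t))

push : ∀ {n} → Letter n → Word n → Word n
push x [] = x ∷ []
push x (y ∷ r) with inverse? x y
... | true  = r
... | false = x ∷ y ∷ r

reduce : ∀ {n} → Word n → Word n
reduce [] = []
reduce (x ∷ w) = push x (reduce w)

len : ∀ {n} → Word n → ℕ
len w = Data.List.length (reduce w)

-- w |_S : set every variable in S to 0 (delete its letters)
restrict : ∀ {n} → Word n → Subset n → Word n
restrict [] S = []
restrict ((i , s) ∷ w) S with lookup S i
... | inside  = restrict w S
... | outside = (i , s) ∷ restrict w S

IsZero : ∀ {n} → Word n → Set
IsZero w = reduce w ≡ []

IsSolution : (n k : ℕ) → Word n → Set
IsSolution n k w =
  ¬ IsZero w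
  × (∀ (S : Subset n) → ∣ S ∣ ≡ k → IsZero (restrict w S))
  × (∀ (S : Subset n) → ∣ S ∣ < k → ¬ IsZero (restrict w S))

standard : (n : ℕ) → Word n
standard n = map (λ i → (i , true)) (allFin n) ++ map (λ i → (i , false)) (allFin n)

-- Deleting nails commutes with free reduction, so we may work with the reduced
-- word r of a solution w. Deleting the n − 1 nails other than i leaves the letters of r on nail i,
-- which must cancel; so nail i does not occur exactly once in r. It does occur: otherwise deleting
-- the n − 2 nails other than i and some j ≠ i gives the same word as deleting all nails but j,
-- hence 0, although fewer than n − 1 nails were deleted. So |r| ≥ 2n.
--
-- Deleting nails from 1 + ⋯ + n − 1 − ⋯ − n leaves p₁ + ⋯ + pₖ − p₁ − ⋯ − pₖ
-- on the remaining nails p₁ < ⋯ < pₖ. For k = 1 this cancels; for k ≥ 2 it is reduced, since the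
-- only adjacent letters that could cancel are + pₖ and − p₁.

module Submission where

open import Defs
open import Data.Nat using (ℕ; zero; suc; _+_; _*_; _∸_; _≤_; _<_; z≤n; s≤s)
open import Data.Nat.Properties
  using (+-suc; +-identityʳ; +-mono-≤; +-cancelʳ-≡; +-cancelʳ-≤; *-suc)
open import Data.Bool using (Bool; true; false; not; if_then_else_)
open import Data.Bool.Properties using (not-involutive; ∧-zeroʳ)
open import Data.Fin using (Fin; zero; suc; punchIn)
open import Data.Fin.Properties using (_≟_; punchInᵢ≢i)
open import Data.Fin.Subset using (Subset; inside; outside; ∣_∣; ∁; ⁅_⁆; ⊥; _-_)
open import Data.Fin.Subset.Properties
  using (∣∁p∣≡n∸∣p∣; ∣⁅x⁆∣≡1; p─⊥≡p; x∈p⇒∣p-x∣<∣p∣; x∉p⇒x∈∁p; x≢y⇒x∉⁅y⁆)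
open import Data.Vec using ([]; _∷_; lookup; tabulate; sum)
open import Data.Vec.Properties using (lookup-map; lookup-replicate)
open import Data.List using (List; []; _∷_; _++_; map; length; filter)
import Data.List as List
open import Data.List.Properties using (map-tabulate; length-map; length-++; length-tabulate)
open import Data.List.Relation.Unary.All as All using (All; []; _∷_)
import Data.List.Relation.Unary.All.Properties as All
open import Data.List.Relation.Unary.AllPairs using (_∷_)
open import Data.List.Relation.Unary.Linked as Linked using (Linked; []; [-]; _∷_)
open import Data.List.Relation.Unary.Linked.Properties using (++⁺; map⁺)
open import Data.List.Relation.Unary.Unique.Propositional using (Unique)
import Data.List.Relation.Unary.Unique.Propositional.Properties as Unique
open import Data.Maybe using (just)
open import Data.Maybe.Relation.Binary.Connected using (Connected; just; nothing-just)
open import Data.Product using (_×_; _,_; proj₁; map₁)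
open import Function using (_∘_)
open import Relation.Nullary using (¬_; does; yes; no; contradiction)
open import Relation.Nullary.Decidable using (T?)
open import Relation.Binary.PropositionalEquality
  using (_≡_; _≢_; refl; sym; trans; cong; cong₂; subst; module ≡-Reasoning)

private
  variable
    n : ℕ

inv : Letter n → Letter n
inv (i , s) = (i , not s)

inverse?⇒≡inv : (x y : Letter n) → inverse? x y ≡ true → y ≡ inv x
inverse?⇒≡inv (i , s) (j , t) eq with i ≟ j
inverse?⇒≡inv (i , true)  (.i , false) eq | yes refl = refl
inverse?⇒≡inv (i , false) (.i , true)  eq | yes refl = refl
inverse?⇒≡inv (i , true)  (.i , true)  () | yes refl
inverse?⇒≡inv (i , false) (.i , false) () | yes refl
inverse?⇒≡inv (i , s)     (j , t)      () | no _

inverse?-inv : (x : Letter n) → inverse? x (inv x) ≡ true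
inverse?-inv (i , s) with i ≟ i
inverse?-inv (i , true)  | yes _ = refl
inverse?-inv (i , false) | yes _ = refl
... | no i≢i = contradiction refl i≢i

inv-involutive : (x : Letter n) → inv (inv x) ≡ x
inv-involutive (i , s) = cong (i ,_) (not-involutive s)

inv-injective : {x y : Letter n} → inv x ≡ inv y → x ≡ y
inv-injective {x = x} {y} eq = trans (sym (inv-involutive x)) (trans (cong inv eq) (inv-involutive y))

inverse?-inv-inv : (x y : Letter n) → inverse? (inv x) (inv y) ≡ inverse? x y
inverse?-inv-inv (i , true)  (j , true)  = refl
inverse?-inv-inv (i , true)  (j , false) = refl
inverse?-inv-inv (i , false) (j , true)  = refl
inverse?-inv-inv (i , false) (j , false) = refl

inverse?-same-sign : (i j : Fin n) (s : Bool) → inverse? (i , s) (j , s) ≡ false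
inverse?-same-sign i j true  = ∧-zeroʳ (does (i ≟ j))
inverse?-same-sign i j false = ∧-zeroʳ (does (i ≟ j))

Reduced : Word n → Set
Reduced = Linked (λ x y → inverse? x y ≡ false)

push-reduced : (x : Letter n) {w : Word n} → Reduced w → Reduced (push x w)
push-reduced x {[]}    _ = [-]
push-reduced x {y ∷ w} r with inverse? x y in eq
... | true  = Linked.tail r
... | false = eq ∷ r

reduce-reduced : (w : Word n) → Reduced (reduce w)
reduce-reduced []      = []
reduce-reduced (x ∷ w) = push-reduced x (reduce-reduced w)

push-∷-reduced : {x : Letter n} {w : Word n} → Reduced (x ∷ w) → push x w ≡ x ∷ w
push-∷-reduced {w = []}    [-]      = refl
push-∷-reduced {w = y ∷ w} (xy ∷ _) rewrite xy = refl

reduce-fixes-reduced : {w : Word n} → Reduced w → reduce w ≡ w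
reduce-fixes-reduced []                 = refl
reduce-fixes-reduced [-]                = refl
reduce-fixes-reduced r@(_ ∷ rs) rewrite reduce-fixes-reduced rs = push-∷-reduced r

push-inv-cancel : (x : Letter n) {u : Word n} → Reduced u → push x (push (inv x) u) ≡ u
push-inv-cancel x {[]} _ rewrite inverse?-inv x = refl
push-inv-cancel x {z ∷ u} r with inverse? (inv x) z in e
... | true  = trans (cong (λ y → push y u) x≡z) (push-∷-reduced r)
  where
  x≡z : x ≡ z
  x≡z = trans (sym (inv-involutive x)) (sym (inverse?⇒≡inv (inv x) z e))
... | false rewrite inverse?-inv x = refl

restrict-push : (x : Letter n) (v : Word n) (S : Subset n) →
                reduce (restrict (push x v) S) ≡ reduce (restrict (x ∷ v) S)
restrict-push x [] S = refl
restrict-push x (y ∷ v) S with inverse? x y in eq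
... | false = refl
... | true with inverse?⇒≡inv x y eq
restrict-push (i , s) (.(i , not s) ∷ v) S | true | refl with lookup S i in e
... | inside  rewrite e = refl
... | outside rewrite e = sym (push-inv-cancel (i , s) (reduce-reduced (restrict v S)))

restrict-∷-cong : (x : Letter n) {u v : Word n} (S : Subset n) →
                  reduce (restrict u S) ≡ reduce (restrict v S) →
                  reduce (restrict (x ∷ u) S) ≡ reduce (restrict (x ∷ v) S)
restrict-∷-cong (i , s) S eq with lookup S i
... | inside  = eq
... | outside = cong (push (i , s)) eq

reduce-restrict-reduce : (w : Word n) (S : Subset n) →
                         reduce (restrict (reduce w) S) ≡ reduce (restrict w S)
reduce-restrict-reduce []      S = refl
reduce-restrict-reduce (x ∷ w) S =
  trans (restrict-push x (reduce w) S) (restrict-∷-cong x S (reduce-restrict-reduce w S))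

restrict-++ : (u v : Word n) (S : Subset n) → restrict (u ++ v) S ≡ restrict u S ++ restrict v S
restrict-++ []            v S = refl
restrict-++ ((i , s) ∷ u) v S with lookup S i
... | inside  = restrict-++ u v S
... | outside = cong ((i , s) ∷_) (restrict-++ u v S)

restrict-map-inv : (u : Word n) (S : Subset n) → restrict (map inv u) S ≡ map inv (restrict u S)
restrict-map-inv []            S = refl
restrict-map-inv ((i , s) ∷ u) S with lookup S i
... | inside  = restrict-map-inv u S
... | outside = cong ((i , not s) ∷_) (restrict-map-inv u S)

restrict≡filter : (u : Word n) (S : Subset n) →
                  restrict u S ≡ filter (T? ∘ not ∘ lookup S ∘ proj₁) u
restrict≡filter []            S = refl
restrict≡filter ((i , s) ∷ u) S with lookup S i
... | inside  = restrict≡filter u S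
... | outside = cong ((i , s) ∷_) (restrict≡filter u S)

restrict-shift : (u : Word n) (x : Bool) (S : Subset n) →
                 restrict (map (map₁ suc) u) (x ∷ S) ≡ map (map₁ suc) (restrict u S)
restrict-shift []            x S = refl
restrict-shift ((i , s) ∷ u) x S with lookup S i
... | inside  = restrict-shift u x S
... | outside = cong ((suc i , s) ∷_) (restrict-shift u x S)

occurrences : Word n → Fin n → ℕ
occurrences []            i = 0
occurrences ((j , _) ∷ u) i = if does (j ≟ i) then suc (occurrences u i) else occurrences u i

sum-tabulate-zero : (n : ℕ) → sum (tabulate {n = n} (λ _ → 0)) ≡ 0
sum-tabulate-zero zero    = refl
sum-tabulate-zero (suc n) = sum-tabulate-zero n

sum-tabulate-bump : (j : Fin n) (g : Fin n → ℕ) →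
                    sum (tabulate (λ i → if does (j ≟ i) then suc (g i) else g i)) ≡ suc (sum (tabulate g))
sum-tabulate-bump zero    g = refl
sum-tabulate-bump (suc j) g =
  trans (cong (g zero +_) (sum-tabulate-bump j (g ∘ suc))) (+-suc (g zero) _)

sum-occurrences : (u : Word n) → sum (tabulate (occurrences u)) ≡ length u
sum-occurrences {n} []        = sum-tabulate-zero n
sum-occurrences ((j , _) ∷ u) = trans (sum-tabulate-bump j (occurrences u)) (cong suc (sum-occurrences u))

sum-tabulate-≥ : (f : Fin n → ℕ) → (∀ i → 2 ≤ f i) → 2 * n ≤ sum (tabulate f)
sum-tabulate-≥ {zero}  f 2≤f = z≤n
sum-tabulate-≥ {suc n} f 2≤f rewrite *-suc 2 n =
  +-mono-≤ (2≤f zero) (sum-tabulate-≥ (f ∘ suc) (2≤f ∘ suc))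

lookup-∁⁅⁆ : (i j : Fin n) → lookup (∁ ⁅ i ⁆) j ≡ not (does (j ≟ i))
lookup-∁⁅⁆ zero    zero    = refl
lookup-∁⁅⁆ zero    (suc j) = trans (lookup-map j not ⊥) (cong not (lookup-replicate j outside))
lookup-∁⁅⁆ (suc i) zero    = refl
lookup-∁⁅⁆ (suc i) (suc j) = lookup-∁⁅⁆ i j

lookup-remove : (S : Subset n) {i j : Fin n} → j ≢ i → lookup (S - i) j ≡ lookup S j
lookup-remove (x ∷ S) {zero}  {zero}  j≢i = contradiction refl j≢i
lookup-remove (x ∷ S) {zero}  {suc j} j≢i = cong (λ T → lookup T j) (p─⊥≡p S)
lookup-remove (x ∷ S) {suc i} {zero}  j≢i = refl
lookup-remove (x ∷ S) {suc i} {suc j} j≢i = lookup-remove S (j≢i ∘ cong suc)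

length-restrict-∁⁅⁆ : (u : Word n) (i : Fin n) → length (restrict u (∁ ⁅ i ⁆)) ≡ occurrences u i
length-restrict-∁⁅⁆ []            i = refl
length-restrict-∁⁅⁆ ((j , s) ∷ u) i rewrite lookup-∁⁅⁆ i j with does (j ≟ i)
... | true  = cong suc (length-restrict-∁⁅⁆ u i)
... | false = length-restrict-∁⁅⁆ u i

restrict-remove-absent : (u : Word n) (S : Subset n) {i : Fin n} →
                         occurrences u i ≡ 0 → restrict u (S - i) ≡ restrict u S
restrict-remove-absent []            S absent = refl
restrict-remove-absent ((j , s) ∷ u) S {i} absent with j ≟ i
... | yes refl = contradiction absent λ ()
... | no j≢i rewrite lookup-remove S j≢i with lookup S j
...   | inside  = restrict-remove-absent u S absent
...   | outside = cong ((j , s) ∷_) (restrict-remove-absent u S absent)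

single-letter-nonzero : (u : Word n) → length u ≡ 1 → ¬ IsZero u
single-letter-nonzero (x ∷ []) _ ()

∣∁⁅⁆∣ : (i : Fin n) → ∣ ∁ ⁅ i ⁆ ∣ ≡ n ∸ 1
∣∁⁅⁆∣ {n} i = trans (∣∁p∣≡n∸∣p∣ ⁅ i ⁆) (cong (n ∸_) (∣⁅x⁆∣≡1 i))

solution-vanishes-off : (w : Word n) → IsSolution n (n ∸ 1) w →
                        (i : Fin n) → IsZero (restrict (reduce w) (∁ ⁅ i ⁆))
solution-vanishes-off w (_ , vanish , _) i =
  trans (reduce-restrict-reduce w _) (vanish _ (∣∁⁅⁆∣ i))

solution-not-once : (w : Word n) → IsSolution n (n ∸ 1) w →
                    (i : Fin n) → occurrences (reduce w) i ≢ 1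
solution-not-once w sol i once =
  single-letter-nonzero (restrict (reduce w) (∁ ⁅ i ⁆))
    (trans (length-restrict-∁⁅⁆ (reduce w) i) once) (solution-vanishes-off w sol i)

solution-occurs : (w : Word n) → IsSolution n (n ∸ 1) w →
                  (i j : Fin n) → i ≢ j → occurrences (reduce w) i ≢ 0
solution-occurs w sol@(_ , _ , survive) i j i≢j absent = survive T ∣T∣<n-1 T-vanishes
  where
  T = ∁ ⁅ j ⁆ - i
  ∣T∣<n-1 : ∣ T ∣ < _
  ∣T∣<n-1 = subst (∣ T ∣ <_) (∣∁⁅⁆∣ j) (x∈p⇒∣p-x∣<∣p∣ (x∉p⇒x∈∁p (x≢y⇒x∉⁅y⁆ i≢j)))
  T-vanishes : IsZero (restrict w T)
  T-vanishes = begin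
    reduce (restrict w T)                   ≡⟨ reduce-restrict-reduce w T ⟨
    reduce (restrict (reduce w) T)          ≡⟨ cong reduce (restrict-remove-absent (reduce w) (∁ ⁅ j ⁆) absent) ⟩
    reduce (restrict (reduce w) (∁ ⁅ j ⁆))  ≡⟨ solution-vanishes-off w sol j ⟩
    []                                      ∎
    where open ≡-Reasoning

≢0∧≢1⇒≥2 : {k : ℕ} → k ≢ 0 → k ≢ 1 → 2 ≤ k
≢0∧≢1⇒≥2 {zero}        k≢0 _   = contradiction refl k≢0
≢0∧≢1⇒≥2 {suc zero}    _   k≢1 = contradiction refl k≢1
≢0∧≢1⇒≥2 {suc (suc k)} _   _   = s≤s (s≤s z≤n)

solution-length : {m : ℕ} (w : Word (suc (suc m))) →
                  IsSolution (suc (suc m)) (suc m) w → 2 * suc (suc m) ≤ len w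
solution-length {m} w sol =
  subst (2 * suc (suc m) ≤_) (sum-occurrences (reduce w)) (sum-tabulate-≥ (occurrences (reduce w)) at-least-twice)
  where
  at-least-twice : ∀ i → 2 ≤ occurrences (reduce w) i
  at-least-twice i = ≢0∧≢1⇒≥2 (solution-occurs w sol i (punchIn i zero) (punchInᵢ≢i i zero ∘ sym))
                              (solution-not-once w sol i)

Positive : Letter n → Set
Positive (_ , s) = s ≡ true

positive-reduced : {w : Word n} → All Positive w → Reduced w
positive-reduced []                  = []
positive-reduced (_ ∷ [])            = [-]
positive-reduced {w = (i , _) ∷ (j , _) ∷ _} (refl ∷ ps@(refl ∷ _)) =
  inverse?-same-sign i j true ∷ positive-reduced ps

map-inv-reduced : {w : Word n} → Reduced w → Reduced (map inv w)
map-inv-reduced = map⁺ ∘ Linked.map (λ {x} {y} eq → trans (inverse?-inv-inv x y) eq)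

connected-last : ∀ {a ℓ} {A : Set a} {R : A → A → Set ℓ} {y : A} {xs : List A} →
                 All (λ z → R z y) xs → Connected R (List.last xs) (just y)
connected-last []                 = nothing-just
connected-last (p ∷ [])           = just p
connected-last (_ ∷ ps@(_ ∷ _))   = connected-last ps

distinct-not-inverse? : {x z : Letter n} → x ≢ z → inverse? z (inv x) ≡ false
distinct-not-inverse? {x = x} {z} x≢z with inverse? z (inv x) in e
... | true  = contradiction (inv-injective (inverse?⇒≡inv z (inv x) e)) x≢z
... | false = refl

++-map-inv-reduced : {x y : Letter n} {w : Word n} → Reduced (x ∷ y ∷ w) → Unique (x ∷ y ∷ w) →
                     Reduced ((x ∷ y ∷ w) ++ map inv (x ∷ y ∷ w))
++-map-inv-reduced r (x∉ ∷ _) =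
  ++⁺ r (connected-last (All.map distinct-not-inverse? x∉)) (map-inv-reduced r)

++-map-inv-reduce : {P : Word n} → All Positive P → Unique P → 2 ≤ length P →
                    reduce (P ++ map inv P) ≡ P ++ map inv P
++-map-inv-reduce {P = _ ∷ []}    _   _    (s≤s ())
++-map-inv-reduce {P = _ ∷ _ ∷ _} pos uniq _ = reduce-fixes-reduced (++-map-inv-reduced (positive-reduced pos) uniq)

++-map-inv-nonzero : {P : Word n} → All Positive P → Unique P → 2 ≤ length P → ¬ IsZero (P ++ map inv P)
++-map-inv-nonzero {P = _ ∷ []}    _   _    (s≤s ())
++-map-inv-nonzero {P = _ ∷ _ ∷ _} pos uniq 2≤ vanishes with trans (sym (++-map-inv-reduce pos uniq 2≤)) vanishes
... | ()

singleton-++-map-inv-vanishes : {P : Word n} → length P ≡ 1 → IsZero (P ++ map inv P)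
singleton-++-map-inv-vanishes {P = x ∷ []} _ = push-inv-cancel x []

length-++-map-inv : (P : Word n) → length (P ++ map inv P) ≡ 2 * length P
length-++-map-inv P = begin
  length (P ++ map inv P)        ≡⟨ length-++ P ⟩
  length P + length (map inv P)  ≡⟨ cong (length P +_) (length-map inv P) ⟩
  length P + length P            ≡⟨ cong (length P +_) (+-identityʳ (length P)) ⟨
  2 * length P                   ∎
  where open ≡-Reasoning

restrict-All : ∀ {p} {Q : Letter n → Set p} {u : Word n} (S : Subset n) → All Q u → All Q (restrict u S)
restrict-All {u = u} S qs = subst (All _) (sym (restrict≡filter u S)) (All.filter⁺ _ qs)

restrict-Unique : {u : Word n} (S : Subset n) → Unique u → Unique (restrict u S)
restrict-Unique {u = u} S uniq = subst Unique (sym (restrict≡filter u S)) (Unique.filter⁺ _ uniq)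

generators : (n : ℕ) → Word n
generators n = List.tabulate (_, true)

generators-positive : (n : ℕ) → All Positive (generators n)
generators-positive _ = All.tabulate⁺ (λ _ → refl)

generators-unique : (n : ℕ) → Unique (generators n)
generators-unique _ = Unique.tabulate⁺ (cong proj₁)

standard≡generators++inverses : (n : ℕ) → standard n ≡ generators n ++ map inv (generators n)
standard≡generators++inverses n =
  cong₂ _++_ (map-tabulate (λ i → i) (_, true))
             (trans (map-tabulate (λ i → i) (_, false)) (sym (map-tabulate (_, true) inv)))

length-restrict-shifted-generators : (x : Bool) (S : Subset n) →
  length (restrict (List.tabulate (λ i → (suc i , true))) (x ∷ S)) ≡ length (restrict (generators n) S)
length-restrict-shifted-generators x S = begin
  length (restrict (List.tabulate (λ i → (suc i , true))) (x ∷ S))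
    ≡⟨ cong (λ u → length (restrict u (x ∷ S))) (map-tabulate (_, true) (map₁ suc)) ⟨
  length (restrict (map (map₁ suc) (generators _)) (x ∷ S))
    ≡⟨ cong length (restrict-shift (generators _) x S) ⟩
  length (map (map₁ suc) (restrict (generators _) S))
    ≡⟨ length-map (map₁ suc) (restrict (generators _) S) ⟩
  length (restrict (generators _) S) ∎
  where open ≡-Reasoning

length-restrict-generators : (S : Subset n) → length (restrict (generators n) S) + ∣ S ∣ ≡ n
length-restrict-generators []            = refl
length-restrict-generators (inside  ∷ S) =
  trans (+-suc _ ∣ S ∣) (cong suc (trans (cong (_+ ∣ S ∣) (length-restrict-shifted-generators inside S))
                                          (length-restrict-generators S)))
length-restrict-generators (outside ∷ S) =
  cong suc (trans (cong (_+ ∣ S ∣) (length-restrict-shifted-generators outside S)) (length-restrict-generators S))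

restrict-standard : (S : Subset n) →
  restrict (standard n) S ≡ restrict (generators n) S ++ map inv (restrict (generators n) S)
restrict-standard {n} S = begin
  restrict (standard n) S                 ≡⟨ cong (λ w → restrict w S) (standard≡generators++inverses n) ⟩
  restrict (G ++ map inv G) S             ≡⟨ restrict-++ G (map inv G) S ⟩
  restrict G S ++ restrict (map inv G) S  ≡⟨ cong (restrict G S ++_) (restrict-map-inv G S) ⟩
  restrict G S ++ map inv (restrict G S)  ∎
  where
  open ≡-Reasoning
  G = generators n

restrict-standard-vanishes : {m : ℕ} (S : Subset (suc m)) → ∣ S ∣ ≡ m → IsZero (restrict (standard (suc m)) S)
restrict-standard-vanishes {m} S ∣S∣≡m = subst IsZero (sym (restrict-standard S)) (singleton-++-map-inv-vanishes {P = P}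
  (+-cancelʳ-≡ m (length P) 1 (trans (cong (length P +_) (sym ∣S∣≡m)) (length-restrict-generators S))))
  where
  P = restrict (generators (suc m)) S

restrict-standard-nonzero : (S : Subset n) → 2 + ∣ S ∣ ≤ n → ¬ IsZero (restrict (standard n) S)
restrict-standard-nonzero {n} S 2+∣S∣≤n = subst (¬_ ∘ IsZero) (sym (restrict-standard S))
  (++-map-inv-nonzero {P = P} (restrict-All S (generators-positive n)) (restrict-Unique S (generators-unique n))
    (+-cancelʳ-≤ ∣ S ∣ 2 (length P) (subst (2 + ∣ S ∣ ≤_) (sym (length-restrict-generators S)) 2+∣S∣≤n)))
  where
  P = restrict (generators n) S

2≤length-generators : 2 ≤ n → 2 ≤ length (generators n)
2≤length-generators {n} = subst (2 ≤_) (sym (length-tabulate {n = n} (_, true)))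

standard-nonzero : 2 ≤ n → ¬ IsZero (standard n)
standard-nonzero {n} 2≤n = subst (¬_ ∘ IsZero) (sym (standard≡generators++inverses n))
  (++-map-inv-nonzero (generators-positive n) (generators-unique n) (2≤length-generators 2≤n))

len-standard : 2 ≤ n → len (standard n) ≡ 2 * n
len-standard {n} 2≤n = begin
  len (standard n)          ≡⟨ cong len (standard≡generators++inverses n) ⟩
  len (G ++ map inv G)      ≡⟨ cong length (++-map-inv-reduce (generators-positive n) (generators-unique n)
                                                            (2≤length-generators 2≤n)) ⟩
  length (G ++ map inv G)   ≡⟨ length-++-map-inv G ⟩
  2 * length G              ≡⟨ cong (2 *_) (length-tabulate {n = n} (_, true)) ⟩
  2 * n                     ∎
  where
  open ≡-Reasoning
  G = generators n

proposition2p2 : (n : ℕ) → 2 ≤ n →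
    IsSolution n (n ∸ 1) (standard n)
    × len (standard n) ≡ 2 * n
    × (∀ (w : Word n) → IsSolution n (n ∸ 1) w → 2 * n ≤ len w)
proposition2p2 (suc (suc m)) 2≤n@(s≤s (s≤s _)) =
  (standard-nonzero 2≤n , restrict-standard-vanishes , λ S ∣S∣<m+1 → restrict-standard-nonzero S (s≤s ∣S∣<m+1))
  , len-standard 2≤n
  , solution-length
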